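{- Let $U$ and $V$ be factors of the Tribonacci word $\mathbf{t}$ such that $|V|_0=|U|_0+2$ and $|U|_i=|V|_i+3$ for some $i\in\{1,2\}$. Then there exist factors $u$ and $v$ of $\mathbf{t}$ with $|u|<|U|$, $|v|<|V|$, $|u|\le|v|$, and $|u|_{i-1}=|v|_{i-1}+3$.
   Context: Let $\tau$ be the morphism on $\{0,1,2\}^*$ given by $0\mapsto 01$, $1\mapsto 02$, $2\mapsto 0$, and let $\mathbf{t}=\lim_{n\to\infty}\tau^n(0)$ be its fixed point. A factor is a finite block of consecutive letters of $\mathbf{t}$. For a finite word $w$, $|w|$ is its length and $|w|_a$ the number of occurrences of the letter $a$ in $w$. -}

module Defs where

open import Data.Nat using (ℕ; zero; suc; _+_)
open import Data.List using (List; []; _∷_; _++_; concatMap; length)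
open import Data.Product using (∃; ∃-syntax; _,_)
open import Relation.Binary.PropositionalEquality using (_≡_)

data Letter : Set where
  l0 l1 l2 : Letter

Word : Set
Word = List Letter

τ-letter : Letter → Word
τ-letter l0 = l0 ∷ l1 ∷ []
τ-letter l1 = l0 ∷ l2 ∷ []
τ-letter l2 = l0 ∷ []

τ : Word → Word
τ = concatMap τ-letter

τⁿ0 : ℕ → Word
τⁿ0 zero    = l0 ∷ []
τⁿ0 (suc n) = τ (τⁿ0 n)

-- Each τ^n(0) is a prefix of τ^{n+1}(0), hence of the fixed point t;
-- and every prefix of t is a prefix of some τ^n(0) (the lengths grow unboundedly).
-- So w is a factor of t iff w occurs in some τ^n(0).
Factor : Word → Set
Factor w = ∃[ n ] ∃[ x ] ∃[ y ] (x ++ w ++ y ≡ τⁿ0 n)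

eqL : Letter → Letter → ℕ
eqL l0 l0 = 1
eqL l1 l1 = 1
eqL l2 l2 = 1
eqL _ _ = 0

count : Letter → Word → ℕ
count a []       = 0
count a (b ∷ w)  = eqL b a + count a w

-- predecessor letter i-1 (used only for i ∈ {1,2})
prevL : Letter → Letter
prevL l0 = l0
prevL l1 = l0
prevL l2 = l1

-- Every factor U of t = τ(t) is, up to a partial block at each end, the image τ(v) of a
-- factor v of t, and τ turns occurrences of i - 1 into occurrences of i ∈ {1, 2} while
-- each letter of v contributes exactly one 0.  Desubstituting U therefore gives a
-- factor u with at most |U|₀ + 1 letters and |u|ᵢ₋₁ ≥ |U|ᵢ, and desubstituting V a
-- factor v with at least |V|₀ - 1 = |U|₀ + 1 letters and |v|ᵢ₋₁ ≤ |V|ᵢ.  Cutting v down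
-- to length |U|₀ + 1 and u to the prefix with exactly |v|ᵢ₋₁ + 3 letters i - 1 (counts
-- along prefixes grow in steps of one) gives the required pair.
module Submission where

open import Defs
open import Data.Nat using (ℕ; zero; suc; _+_; _<_; _≤_; z≤n; s≤s; s≤s⁻¹)
open import Data.Nat.Properties
open import Data.List using ([]; _∷_; _++_; length; take; drop)
open import Data.List.Properties using (++-assoc; ++-cancelˡ; ∷-injective; ∷-injectiveˡ; ∷-injectiveʳ; concatMap-++; length-++; length-take; take++drop≡id)
open import Data.Sum using (_⊎_; inj₁; inj₂)
open import Data.Product using (∃-syntax; _×_; _,_)
open import Relation.Binary.PropositionalEquality using (_≡_; refl; sym; trans; subst; cong; cong₂; module ≡-Reasoning)

infix 4 _⊑_

_⊑_ : Word → Word → Set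
u ⊑ w = ∃[ x ] ∃[ y ] (x ++ u ++ y ≡ w)

prefix-⊑ : ∀ {u y w} → u ++ y ≡ w → u ⊑ w
prefix-⊑ {y = y} e = [] , y , e

infix-⊑ : ∀ p v q → v ⊑ p ++ v ++ q
infix-⊑ p v q = p , q , refl

take-⊑ : ∀ k u → take k u ⊑ u
take-⊑ k u = prefix-⊑ (take++drop≡id k u)

⊑-++ˡ : ∀ a {u w} → u ⊑ w → u ⊑ a ++ w
⊑-++ˡ a (x , y , refl) = a ++ x , y , ++-assoc a x _

⊑-trans : ∀ {u v w} → u ⊑ v → v ⊑ w → u ⊑ w
⊑-trans {u} (x , y , refl) (x′ , y′ , refl) = x′ ++ x , y ++ y′ , (begin
  (x′ ++ x) ++ u ++ y ++ y′   ≡⟨ ++-assoc x′ x _ ⟩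
  x′ ++ x ++ u ++ y ++ y′     ≡⟨ cong (λ z → x′ ++ x ++ z) (++-assoc u y y′) ⟨
  x′ ++ x ++ (u ++ y) ++ y′   ≡⟨ cong (x′ ++_) (++-assoc x (u ++ y) y′) ⟨
  x′ ++ (x ++ u ++ y) ++ y′   ∎)
  where open ≡-Reasoning

factor⇒⊑τ : ∀ {U} → Factor U → ∃[ n ] U ⊑ τ (τⁿ0 n)
factor⇒⊑τ (zero , U⊑0) = zero , ⊑-trans U⊑0 (prefix-⊑ refl)
factor⇒⊑τ (suc n , U⊑) = n , U⊑

count-++ : ∀ a u v → count a (u ++ v) ≡ count a u + count a v
count-++ a []      v = refl
count-++ a (b ∷ u) v = trans (cong (eqL b a +_) (count-++ a u v)) (sym (+-assoc (eqL b a) _ _))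

count-⊑ : ∀ a {u w} → u ⊑ w → count a u ≤ count a w
count-⊑ a {u} (x , y , refl) rewrite count-++ a x (u ++ y) | count-++ a u y =
  ≤-trans (m≤m+n (count a u) _) (m≤n+m _ (count a x))

eqL≡0⊎1 : ∀ b a → eqL b a ≡ 0 ⊎ eqL b a ≡ 1
eqL≡0⊎1 l0 l0 = inj₂ refl
eqL≡0⊎1 l0 l1 = inj₁ refl
eqL≡0⊎1 l0 l2 = inj₁ refl
eqL≡0⊎1 l1 l0 = inj₁ refl
eqL≡0⊎1 l1 l1 = inj₂ refl
eqL≡0⊎1 l1 l2 = inj₁ refl
eqL≡0⊎1 l2 l0 = inj₁ refl
eqL≡0⊎1 l2 l1 = inj₁ refl
eqL≡0⊎1 l2 l2 = inj₂ refl

count≤length : ∀ a w → count a w ≤ length w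
count≤length a []      = z≤n
count≤length a (b ∷ w) with eqL b a | eqL≡0⊎1 b a
... | _ | inj₁ refl = m≤n⇒m≤1+n (count≤length a w)
... | _ | inj₂ refl = s≤s (count≤length a w)

count₀+count≤length : ∀ {i} → i ≡ l1 ⊎ i ≡ l2 → ∀ w → count l0 w + count i w ≤ length w
count₀+count≤length _ [] = z≤n
count₀+count≤length (inj₁ refl) (l0 ∷ w) = s≤s (count₀+count≤length (inj₁ refl) w)
count₀+count≤length (inj₂ refl) (l0 ∷ w) = s≤s (count₀+count≤length (inj₂ refl) w)
count₀+count≤length (inj₁ refl) (l1 ∷ w) rewrite +-suc (count l0 w) (count l1 w) =
  s≤s (count₀+count≤length (inj₁ refl) w)
count₀+count≤length (inj₂ refl) (l1 ∷ w) = m≤n⇒m≤1+n (count₀+count≤length (inj₂ refl) w)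
count₀+count≤length (inj₁ refl) (l2 ∷ w) = m≤n⇒m≤1+n (count₀+count≤length (inj₁ refl) w)
count₀+count≤length (inj₂ refl) (l2 ∷ w) rewrite +-suc (count l0 w) (count l2 w) =
  s≤s (count₀+count≤length (inj₂ refl) w)

count-take-intermediate : ∀ a u {T} → T ≤ count a u → ∃[ k ] count a (take k u) ≡ T
count-take-intermediate a u       {zero}  _ = 0 , refl
count-take-intermediate a (b ∷ u) {suc T} h with eqL≡0⊎1 b a
... | inj₁ b≉a rewrite b≉a =
  let k , e = count-take-intermediate a u h in suc k , trans (cong (_+ _) b≉a) e
... | inj₂ b≈a rewrite b≈a =
  let k , e = count-take-intermediate a u (s≤s⁻¹ h) in suc k , trans (cong (_+ _) b≈a) (cong suc e)

τ-++ : ∀ u v → τ (u ++ v) ≡ τ u ++ τ v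
τ-++ = concatMap-++ τ-letter

count₀-τ : ∀ w → count l0 (τ w) ≡ length w
count₀-τ []       = refl
count₀-τ (l0 ∷ w) = cong suc (count₀-τ w)
count₀-τ (l1 ∷ w) = cong suc (count₀-τ w)
count₀-τ (l2 ∷ w) = cong suc (count₀-τ w)

count-τ-letter : ∀ {i} → i ≡ l1 ⊎ i ≡ l2 → ∀ c → count i (τ-letter c) ≡ eqL c (prevL i)
count-τ-letter (inj₁ refl) l0 = refl
count-τ-letter (inj₁ refl) l1 = refl
count-τ-letter (inj₁ refl) l2 = refl
count-τ-letter (inj₂ refl) l0 = refl
count-τ-letter (inj₂ refl) l1 = refl
count-τ-letter (inj₂ refl) l2 = refl

count-τ : ∀ {i} → i ≡ l1 ⊎ i ≡ l2 → ∀ w → count i (τ w) ≡ count (prevL i) w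
count-τ hi []          = refl
count-τ {i} hi (c ∷ w) =
  trans (count-++ i (τ-letter c) (τ w)) (cong₂ _+_ (count-τ-letter hi c) (count-τ hi w))

-- A factor of τ w may begin after the initial 0 of the image of a letter c and end just
-- after the initial 0 of the image of a letter d.
data LeftOverhang : Word → Word → Set where
  none : LeftOverhang [] []
  tail : ∀ c → LeftOverhang (c ∷ []) (drop 1 (τ-letter c))

data RightOverhang : Word → Word → Set where
  none : RightOverhang [] []
  head : ∀ d → RightOverhang (d ∷ []) (l0 ∷ [])

record Desubstitution (U w : Word) : Set where
  constructor desub
  field
    p v q s r : Word
    occurs    : p ++ v ++ q ⊑ w
    shape     : U ≡ s ++ τ v ++ r
    left      : LeftOverhang p s
    right     : RightOverhang q r

τ-prefix : ∀ U y w → U ++ y ≡ τ w →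
  ∃[ v ] ∃[ q ] ∃[ r ] ∃[ z ] (w ≡ v ++ q ++ z × U ≡ τ v ++ r × RightOverhang q r)
τ-prefix []      y w        e = [] , [] , [] , w , refl , refl , none
τ-prefix (a ∷ U) y (l2 ∷ w) e with refl , e′ ← ∷-injective e with τ-prefix U y w e′
... | v , q , r , z , refl , refl , o = l2 ∷ v , q , r , z , refl , refl , o
τ-prefix (a ∷ []) y (l0 ∷ w) e with refl ← ∷-injectiveˡ e =
  [] , l0 ∷ [] , l0 ∷ [] , w , refl , refl , head l0
τ-prefix (a ∷ []) y (l1 ∷ w) e with refl ← ∷-injectiveˡ e =
  [] , l1 ∷ [] , l0 ∷ [] , w , refl , refl , head l1
τ-prefix (a ∷ b ∷ U) y (l0 ∷ w) e with refl , e′ ← ∷-injective e with refl , e″ ← ∷-injective e′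
  with τ-prefix U y w e″
... | v , q , r , z , refl , refl , o = l0 ∷ v , q , r , z , refl , refl , o
τ-prefix (a ∷ b ∷ U) y (l1 ∷ w) e with refl , e′ ← ∷-injective e with refl , e″ ← ∷-injective e′
  with τ-prefix U y w e″
... | v , q , r , z , refl , refl , o = l1 ∷ v , q , r , z , refl , refl , o

desub-[] : ∀ {w} → Desubstitution [] w
desub-[] {w} = desub [] [] [] [] [] (prefix-⊑ refl) refl none none

desub-after : ∀ {p s U y z} → LeftOverhang p s → U ++ y ≡ τ z → Desubstitution (s ++ U) (p ++ z)
desub-after {p} {s} {U} {y} {z} o e with τ-prefix U y z e
... | v , q , r , z′ , refl , refl , o′ =
  desub p v q s r (prefix-⊑ (trans (++-assoc p (v ++ q) z′) (cong (p ++_) (++-assoc v q z′)))) refl o o′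

desub-inside : ∀ c {U y z} → l0 ∷ U ++ y ≡ τ (c ∷ z) → Desubstitution U (c ∷ z)
desub-inside c  {[]}    e = desub-[]
desub-inside l0 {a ∷ U} e with refl , e′ ← ∷-injective (∷-injectiveʳ e) = desub-after (tail l0) e′
desub-inside l1 {a ∷ U} e with refl , e′ ← ∷-injective (∷-injectiveʳ e) = desub-after (tail l1) e′
desub-inside l2 {a ∷ U} e = desub-after (tail l2) (∷-injectiveʳ e)

desub-++ˡ : ∀ a {U w} → Desubstitution U w → Desubstitution U (a ++ w)
desub-++ˡ a (desub p v q s r occurs shape left right) = desub p v q s r (⊑-++ˡ a occurs) shape left right

desubstitute : ∀ {U w} → U ⊑ τ w → Desubstitution U w
desubstitute {U} {w} (x , y , e) with τ-prefix x (U ++ y) w e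
... | a , q , r , z , refl , refl , o = desub-++ˡ a (after o rest)
  where
  rest : r ++ U ++ y ≡ τ (q ++ z)
  rest = ++-cancelˡ (τ a) _ _ (begin
    τ a ++ r ++ U ++ y     ≡⟨ ++-assoc (τ a) r _ ⟨
    (τ a ++ r) ++ U ++ y  ≡⟨ e ⟩
    τ (a ++ q ++ z)       ≡⟨ τ-++ a (q ++ z) ⟩
    τ a ++ τ (q ++ z)     ∎)
    where open ≡-Reasoning
  after : ∀ {q r} → RightOverhang q r → r ++ U ++ y ≡ τ (q ++ z) → Desubstitution U (q ++ z)
  after none     = desub-after none
  after (head d) = desub-inside d

leftOverhang-length : ∀ {p s} → LeftOverhang p s → length p ≤ 1
leftOverhang-length none     = z≤n
leftOverhang-length (tail _) = s≤s z≤n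

rightOverhang-length : ∀ {q r} → RightOverhang q r → length q ≤ 1
rightOverhang-length none     = z≤n
rightOverhang-length (head _) = s≤s z≤n

leftOverhang-count₀ : ∀ {p s} → LeftOverhang p s → count l0 s ≡ 0
leftOverhang-count₀ none      = refl
leftOverhang-count₀ (tail l0) = refl
leftOverhang-count₀ (tail l1) = refl
leftOverhang-count₀ (tail l2) = refl

rightOverhang-count₀ : ∀ {q r} → RightOverhang q r → count l0 r ≡ length q
rightOverhang-count₀ none     = refl
rightOverhang-count₀ (head _) = refl

leftOverhang-count : ∀ {i p s} → i ≡ l1 ⊎ i ≡ l2 → LeftOverhang p s → count i s ≡ count (prevL i) p
leftOverhang-count _           none      = refl
leftOverhang-count (inj₁ refl) (tail l0) = refl
leftOverhang-count (inj₁ refl) (tail l1) = refl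
leftOverhang-count (inj₁ refl) (tail l2) = refl
leftOverhang-count (inj₂ refl) (tail l0) = refl
leftOverhang-count (inj₂ refl) (tail l1) = refl
leftOverhang-count (inj₂ refl) (tail l2) = refl

rightOverhang-count : ∀ {i q r} → i ≡ l1 ⊎ i ≡ l2 → RightOverhang q r → count i r ≡ 0
rightOverhang-count _           none     = refl
rightOverhang-count (inj₁ refl) (head _) = refl
rightOverhang-count (inj₂ refl) (head _) = refl

count-++³ : ∀ a x y z → count a (x ++ y ++ z) ≡ count a x + (count a y + count a z)
count-++³ a x y z = trans (count-++ a x (y ++ z)) (cong (count a x +_) (count-++ a y z))

length-++³ : ∀ (x y z : Word) → length (x ++ y ++ z) ≡ length x + (length y + length z)
length-++³ x y z = trans (length-++ x) (cong (length x +_) (length-++ y))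

desub-count₀ : ∀ {p s q r} → LeftOverhang p s → RightOverhang q r →
  ∀ v → count l0 (s ++ τ v ++ r) ≡ length v + length q
desub-count₀ {s = s} {r = r} left right v = trans (count-++³ l0 s (τ v) r)
  (cong₂ _+_ (leftOverhang-count₀ left) (cong₂ _+_ (count₀-τ v) (rightOverhang-count₀ right)))

desub-count : ∀ {i p s q r} → i ≡ l1 ⊎ i ≡ l2 → LeftOverhang p s → RightOverhang q r →
  ∀ v → count i (s ++ τ v ++ r) ≡ count (prevL i) p + count (prevL i) v
desub-count {i} {s = s} {r = r} hi left right v = trans (count-++³ i s (τ v) r)
  (cong₂ _+_ (leftOverhang-count hi left)
    (trans (cong₂ _+_ (count-τ hi v) (rightOverhang-count hi right)) (+-identityʳ _)))

upper-desubstitution : ∀ {i U w} → i ≡ l1 ⊎ i ≡ l2 → U ⊑ τ w →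
  ∃[ u ] (u ⊑ w × length u ≤ suc (count l0 U) × count i U ≤ count (prevL i) u)
upper-desubstitution {i} hi U⊑ with desubstitute U⊑
... | desub p v q s r occurs refl left right = p ++ v ++ q , occurs , length-bound , count-bound
  where
  open ≤-Reasoning
  length-bound : length (p ++ v ++ q) ≤ suc (count l0 (s ++ τ v ++ r))
  length-bound = begin
    length (p ++ v ++ q)                ≡⟨ length-++³ p v q ⟩
    length p + (length v + length q)    ≤⟨ +-monoˡ-≤ _ (leftOverhang-length left) ⟩
    suc (length v + length q)           ≡⟨ cong suc (desub-count₀ left right v) ⟨
    suc (count l0 (s ++ τ v ++ r))      ∎
  count-bound : count i (s ++ τ v ++ r) ≤ count (prevL i) (p ++ v ++ q)
  count-bound = begin
    count i (s ++ τ v ++ r)        ≡⟨ desub-count hi left right v ⟩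
    cₐ p + cₐ v                    ≤⟨ +-monoʳ-≤ (cₐ p) (m≤m+n (cₐ v) (cₐ q)) ⟩
    cₐ p + (cₐ v + cₐ q)           ≡⟨ count-++³ (prevL i) p v q ⟨
    cₐ (p ++ v ++ q)               ∎
    where
    cₐ : Word → ℕ
    cₐ = count (prevL i)

lower-desubstitution : ∀ {i U w} → i ≡ l1 ⊎ i ≡ l2 → U ⊑ τ w →
  ∃[ v ] (v ⊑ w × count l0 U ≤ suc (length v) × count (prevL i) v ≤ count i U)
lower-desubstitution {i} hi U⊑ with desubstitute U⊑
... | desub p v q s r occurs refl left right =
  v , ⊑-trans (infix-⊑ p v q) occurs , length-bound , count-bound
  where
  open ≤-Reasoning
  length-bound : count l0 (s ++ τ v ++ r) ≤ suc (length v)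
  length-bound = begin
    count l0 (s ++ τ v ++ r)  ≡⟨ desub-count₀ left right v ⟩
    length v + length q       ≤⟨ +-monoʳ-≤ (length v) (rightOverhang-length right) ⟩
    length v + 1              ≡⟨ +-comm (length v) 1 ⟩
    suc (length v)            ∎
  count-bound : count (prevL i) v ≤ count i (s ++ τ v ++ r)
  count-bound = begin
    count (prevL i) v                      ≤⟨ m≤n+m _ _ ⟩
    count (prevL i) p + count (prevL i) v  ≡⟨ desub-count hi left right v ⟨
    count i (s ++ τ v ++ r)                ∎

length-take≤ : ∀ k (u : Word) → length (take k u) ≤ length u
length-take≤ k u = ≤-trans (≤-reflexive (length-take k u)) (m⊓n≤n k (length u))

preimage-factor-with-count : ∀ {i U T} → i ≡ l1 ⊎ i ≡ l2 → Factor U → T ≤ count i U →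
  ∃[ u ] (Factor u × length u ≤ suc (count l0 U) × count (prevL i) u ≡ T)
preimage-factor-with-count {i} hi U-factor T≤ =
  let n , U⊑ = factor⇒⊑τ U-factor
      u , u⊑ , |u|≤ , Uᵢ≤ = upper-desubstitution hi U⊑
      k , uₖ≡ = count-take-intermediate (prevL i) u (≤-trans T≤ Uᵢ≤)
  in take k u , (n , ⊑-trans (take-⊑ k u) u⊑) , ≤-trans (length-take≤ k u) |u|≤ , uₖ≡

preimage-factor-of-length : ∀ {i V N} → i ≡ l1 ⊎ i ≡ l2 → Factor V → suc N ≤ count l0 V →
  ∃[ v ] (Factor v × length v ≡ N × count (prevL i) v ≤ count i V)
preimage-factor-of-length {i} {V} {N} hi V-factor N<V₀ =
  let n , V⊑ = factor⇒⊑τ V-factor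
      v , v⊑ , V₀≤ , vₐ≤ = lower-desubstitution hi V⊑
  in take N v , (n , ⊑-trans (take-⊑ N v) v⊑)
   , trans (length-take N v) (m≤n⇒m⊓n≡m (s≤s⁻¹ (≤-trans N<V₀ V₀≤)))
   , ≤-trans (count-⊑ (prevL i) (take-⊑ N v)) vₐ≤

lemma2 : (U V : Word) → Factor U → Factor V → (i : Letter) → (i ≡ l1 ⊎ i ≡ l2)
    → count l0 V ≡ count l0 U + 2 → count i U ≡ count i V + 3
    → ∃[ u ] ∃[ v ] (Factor u × Factor v × length u < length U × length v < length V
        × length u ≤ length v × count (prevL i) u ≡ count (prevL i) v + 3)
lemma2 U V U-factor V-factor i hi V₀≡ Uᵢ≡ =
  let v , v-factor , |v|≡ , vₐ≤ = preimage-factor-of-length hi V-factor 2+Z≤V₀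
      u , u-factor , |u|≤ , uₐ≡ = preimage-factor-with-count hi U-factor (vₐ+3≤Uᵢ v vₐ≤)
  in u , v , u-factor , v-factor , ≤-<-trans |u|≤ 1+Z<|U|
   , subst (_< length V) (sym |v|≡) (≤-trans 2+Z≤V₀ (count≤length l0 V))
   , subst (length u ≤_) (sym |v|≡) |u|≤ , uₐ≡
  where
  open ≤-Reasoning
  Z : ℕ
  Z = count l0 U
  2+Z≤V₀ : suc (suc Z) ≤ count l0 V
  2+Z≤V₀ = ≤-reflexive (trans (+-comm 2 Z) (sym V₀≡))
  vₐ+3≤Uᵢ : ∀ v → count (prevL i) v ≤ count i V → count (prevL i) v + 3 ≤ count i U
  vₐ+3≤Uᵢ _ vₐ≤ = ≤-trans (+-monoˡ-≤ 3 vₐ≤) (≤-reflexive (sym Uᵢ≡))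
  1+Z<|U| : suc Z < length U
  1+Z<|U| = begin-strict
    suc Z                ≡⟨ +-comm 1 Z ⟩
    Z + 1                <⟨ +-monoʳ-< Z (s≤s (s≤s z≤n)) ⟩
    Z + 3                ≤⟨ +-monoʳ-≤ Z (m≤n+m 3 (count i V)) ⟩
    Z + (count i V + 3)  ≡⟨ cong (Z +_) Uᵢ≡ ⟨
    Z + count i U        ≤⟨ count₀+count≤length hi U ⟩
    length U             ∎
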